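{- Let $(\cdot)^*$ be a realizability interpretation of $\mathcal T$ in $\mathcal U$. For every formula $A$ of $\mathcal T$ with free variables $x_1,\ldots,x_n$ of sorts $s_1,\ldots,s_n$: $$\mathcal U\vdash\forall x_1^*\cdots\forall x_n^*\,\forall\pi\,\bigl(s_1^*(x_1^*)\land\cdots\land s_n^*(x_n^*)\land\pi\Vdash A\Rightarrow\ulcorner\mathrm{SN}\urcorner(\pi)\bigr).$$
   Context: Setting for $\mathcal T$. $\mathcal T$ is a many-sorted first-order theory in deduction modulo, given by a congruence $\equiv$ on formulas; its proofs are those of intuitionistic natural deduction in which every rule is applied modulo $\equiv$. Proofs are written as proof-terms $\pi::=\alpha\mid\lambda\alpha\,\pi\mid(\pi\,\pi')\mid\langle\pi,\pi'\rangle\mid\mathrm{fst}(\pi)\mid\mathrm{snd}(\pi)\mid i(\pi)\mid j(\pi)\mid(\delta\,\pi_1\,\alpha\pi_2\,\beta\pi_3)\mid I\mid(\delta_\bot\,\pi)\mid\lambda x\,\pi\mid(\pi\,t)\mid\langle t,\pi\rangle\mid(\delta_\exists\,\pi\,x\alpha\pi')$ ($\alpha,\beta$ proof variables, $x$ term variables, $t$ terms), for the rules axiom, $\Rightarrow$-intro/elim, $\land$-intro/elim$_{1,2}$, $\lor$-intro$_{1,2}$/elim, $\top$-intro, $\bot$-elim, $\forall$-intro/elim, $\exists$-intro/elim; proof-terms built by an elimination constructor are eliminations. Reduction is generated by $(\lambda\alpha\,\pi_1)\,\pi_2\triangleright\pi_1[\alpha:=\pi_2]$, $\mathrm{fst}\langle\pi_1,\pi_2\rangle\triangleright\pi_1$,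 $\mathrm{snd}\langle\pi_1,\pi_2\rangle\triangleright\pi_2$, $(\delta\,i(\pi_1)\,\alpha\pi_2\,\beta\pi_3)\triangleright\pi_2[\alpha:=\pi_1]$, $(\delta\,j(\pi_1)\,\alpha\pi_2\,\beta\pi_3)\triangleright\pi_3[\beta:=\pi_1]$, $(\lambda x\,\pi)\,t\triangleright\pi[x:=t]$, $(\delta_\exists\,\langle t,\pi_1\rangle\,x\alpha\pi_2)\triangleright\pi_2[x:=t,\alpha:=\pi_1]$. Coding. $\mathcal L$ is a language of finite trees generated by finitely many constructors (including $0$ and unary $s$ for naturals) in which the syntax of $\mathcal T$ is encoded. $\mathcal S$ is the one-sorted first-order theory with function symbols the constructors plus one symbol per primitive recursive function on $\mathcal L$, only predicate $=$, and axioms: equality axioms, injectivity and non-confusion of constructors, defining equations of the primitive recursive symbols, and the structural induction schema on $\mathcal L$. A primitive recursive relation $R$ is represented in $\mathcal S$ by $f_R(x_1,\ldots,x_n)=1$, $f_R$ its characteristic function. Used primitive recursive relations: $\mathrm{Nat}(x)$, $\mathrm{Term}(x,y)$ ($x$ is a term of sort $y$), $\mathrm{ProofVar}(x)$, $\mathrm{Proof}(x)$, $\mathrm{Elim}(x)$, $\mathrm{Red}(x,y)$ (one-step reduction), $\mathrm{Red}_n(x,n,y)$ ($n$-step reduction); $\mathrm{Red}^*(x,y):=\exists n(\mathrm{Nat}(n)\land\mathrm{Red}_n(x,n,y))$; $\mathrm{SN}(x):=\mathrm{Proof}(x)\land\exists n(\mathrm{Nat}(n)\land\forall y(\mathrm{Proof}(y)\Rightarrow\lnot\mathrm{Red}_n(x,n,y)))$.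 Function symbols $\mathrm{Axiom}$, $\mathrm{ImpI}(\alpha,\pi)$, $\mathrm{AndI}(\pi_1,\pi_2)$, $\mathrm{OrI}_1(\pi)$, $\mathrm{OrI}_2(\pi)$, $\mathrm{ForallI}(v,\pi)$, $\mathrm{ExistsI}(t,\pi)$ build codes of $\alpha$, $\lambda\alpha\,\pi$, $\langle\pi_1,\pi_2\rangle$, $i(\pi)$, $j(\pi)$, $\lambda v\,\pi$, $\langle t,\pi\rangle$; $\mathrm{TSubst}(\pi,v,t)$, $\mathrm{PSubst}(\pi,\alpha,\varphi)$ compute term-substitution and proof-substitution in $\pi$. $\mathcal U$ expresses syntactic constructions: it comes with an interpretation $\ulcorner\cdot\urcorner$ of $\mathcal S$ in $\mathcal U$ (sorts to sorts with provably inhabited relativization predicates, formulas to formulas commuting provably with connectives and relativized quantifiers, axioms to theorems), structural on terms (function symbols as term macros) and formulas; its target sort is $\ulcorner\mathcal L\urcorner$, with relativization predicate $\ulcorner\mathcal L\urcorner(x)$; $\ulcorner t\urcorner$ is the code of a tree $t$, and $\ulcorner\mathrm{SN}\urcorner$, $\ulcorner\mathrm{ImpI}\urcorner$, etc. are translations. Realizability translation of $\mathcal T$ in $\mathcal U$: maps each sort $s$ to a sort $s_*$ with predicate $s^*(x)$; variables $x$ of sort $s$ to $x^*$ of sort $s_*$; function symbols $f$ of rank $\langle s_1,\ldots,s_n,s\rangle$ to terms $f^*(z_1,\ldots,z_n)$ of sort $s_*$; predicate symbols $p$ of rank $\langle s_1,\ldots,s_n\rangle$ to formulas $\pi\Vdash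 p(z_1,\ldots,z_n)$ of $\mathcal U$ ($\pi$ of sort $\ulcorner\mathcal L\urcorner$). Terms: $x^*$, $(f(t_1,\ldots,t_n))^*=f^*(t_1^*,\ldots,t_n^*)$. Formulas (all of $\pi,\pi',\pi_1,\pi_2,\alpha,\varphi,v,t$ of sort $\ulcorner\mathcal L\urcorner$): $\pi\Vdash p(t_1,\ldots,t_n)$ is $\pi\Vdash p(z_1,\ldots,z_n)$ with $z_i:=t_i^*$; $\pi\Vdash\top\equiv\pi\Vdash\bot\equiv\ulcorner\mathrm{SN}\urcorner(\pi)$; $\pi\Vdash A\Rightarrow B\equiv\ulcorner\mathrm{SN}\urcorner(\pi)\land\forall\alpha\forall\pi'(\ulcorner\mathrm{Red}^*\urcorner(\pi,\ulcorner\mathrm{ImpI}\urcorner(\alpha,\pi'))\Rightarrow\forall\varphi(\varphi\Vdash A\Rightarrow\ulcorner\mathrm{PSubst}\urcorner(\pi',\alpha,\varphi)\Vdash B))$; $\pi\Vdash A\land B\equiv\ulcorner\mathrm{SN}\urcorner(\pi)\land\forall\pi_1\forall\pi_2(\ulcorner\mathrm{Red}^*\urcorner(\pi,\ulcorner\mathrm{AndI}\urcorner(\pi_1,\pi_2))\Rightarrow\pi_1\Vdash A\land\pi_2\Vdash B)$; $\pi\Vdash A\lor B\equiv\ulcorner\mathrm{SN}\urcorner(\pi)\land\forall\pi_1(\ulcorner\mathrm{Red}^*\urcorner(\pi,\ulcorner\mathrm{OrI}_1\urcorner(\pi_1))\Rightarrow\pi_1\Vdash A)\land\forall\pi_2(\ulcorner\mathrm{Red}^*\urcorner(\pi,\ulcorner\mathrm{OrI}_2\urcorner(\pi_2))\Rightarrow\pi_2\Vdash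 B)$; for $x$ of sort $s$: $\pi\Vdash\forall x\,A\equiv\ulcorner\mathrm{SN}\urcorner(\pi)\land\forall v\forall\pi'(\ulcorner\mathrm{Red}^*\urcorner(\pi,\ulcorner\mathrm{ForallI}\urcorner(v,\pi'))\Rightarrow\forall x^*\forall t(s^*(x^*)\land\ulcorner\mathrm{Term}\urcorner(t,\ulcorner s\urcorner)\Rightarrow\ulcorner\mathrm{TSubst}\urcorner(\pi',v,t)\Vdash A))$; $\pi\Vdash\exists x\,A\equiv\ulcorner\mathrm{SN}\urcorner(\pi)\land\forall\pi'\forall t(\ulcorner\mathrm{Red}^*\urcorner(\pi,\ulcorner\mathrm{ExistsI}\urcorner(t,\pi'))\Rightarrow\exists x^*(s^*(x^*)\land\pi'\Vdash A))$. $\mathrm{CR}_\pi(A(\pi))$ is the conjunction of $\forall\pi(A(\pi)\Rightarrow\ulcorner\mathrm{Proof}\urcorner(\pi)\land\ulcorner\mathrm{SN}\urcorner(\pi))$, $\forall\alpha(\ulcorner\mathrm{ProofVar}\urcorner(\alpha)\Rightarrow A(\ulcorner\mathrm{Axiom}\urcorner(\alpha)))$, $\forall\pi\forall\pi'(A(\pi)\land\ulcorner\mathrm{Red}\urcorner(\pi,\pi')\Rightarrow A(\pi'))$, $\forall\pi(\ulcorner\mathrm{Elim}\urcorner(\pi)\land\forall\pi'(\ulcorner\mathrm{Red}\urcorner(\pi,\pi')\Rightarrow A(\pi'))\Rightarrow A(\pi))$. A realizability interpretation is a realizability translation such that: (1) $\mathcal U\vdash\exists x\,s^*(x)$ for each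 sort $s$; (2) for each $f$ of rank $\langle s_1,\ldots,s_n,s\rangle$, $\mathcal U\vdash\forall\vec z(s_1^*(z_1)\land\cdots\land s_n^*(z_n)\Rightarrow s^*(f^*(z_1,\ldots,z_n)))$; (3) for each $p$ of rank $\langle s_1,\ldots,s_n\rangle$, $\mathcal U\vdash\forall\vec z(s_1^*(z_1)\land\cdots\land s_n^*(z_n)\Rightarrow\mathrm{CR}_\pi(\pi\Vdash p(z_1,\ldots,z_n)))$; (4) for all $A\equiv A'$ with free variables $x_1,\ldots,x_n$ of sorts $s_1,\ldots,s_n$, $\mathcal U\vdash\forall\vec x^*(s_1^*(x_1^*)\land\cdots\land s_n^*(x_n^*)\Rightarrow\forall\pi(\pi\Vdash A\Leftrightarrow\pi\Vdash A'))$. -}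

module Defs where

open import Data.List using (List; []; _∷_; map; _++_)
open import Data.List.Membership.Propositional using (_∈_)

-- Many-sorted first-order signatures and syntax (intrinsically scoped,
-- de Bruijn variables; a context lists the sorts of the free variables,
-- the head of the list being the most recently bound variable).

record Signature : Set₁ where
  field
    Sort     : Set
    Fun      : Set
    funArgs  : Fun → List Sort
    funRes   : Fun → Sort
    Pred     : Set
    predArgs : Pred → List Sort

module Syntax (Σ : Signature) where
  open Signature Σ

  Ctx : Set
  Ctx = List Sort

  data Var : Ctx → Sort → Set where
    vz : ∀ {Γ s} → Var (s ∷ Γ) s
    vs : ∀ {Γ s s'} → Var Γ s → Var (s' ∷ Γ) s

  data Term (Γ : Ctx) : Sort → Set
  data Terms (Γ : Ctx) : List Sort → Set

  data Term Γ where
    var : ∀ {s} → Var Γ s → Term Γ s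
    app : (f : Fun) → Terms Γ (funArgs f) → Term Γ (funRes f)

  data Terms Γ where
    []  : Terms Γ []
    _∷_ : ∀ {s ss} → Term Γ s → Terms Γ ss → Terms Γ (s ∷ ss)

  infixr 6 _∧ᶠ_
  infixr 5 _∨ᶠ_
  infixr 4 _⇛_

  data Formula (Γ : Ctx) : Set where
    atom  : (p : Pred) → Terms Γ (predArgs p) → Formula Γ
    Top   : Formula Γ
    Bot   : Formula Γ
    _⇛_   : Formula Γ → Formula Γ → Formula Γ
    _∧ᶠ_  : Formula Γ → Formula Γ → Formula Γ
    _∨ᶠ_  : Formula Γ → Formula Γ → Formula Γ
    ∀ᶠ    : (s : Sort) → Formula (s ∷ Γ) → Formula Γ
    ∃ᶠ    : (s : Sort) → Formula (s ∷ Γ) → Formula Γ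

  _⇔ᶠ_ : ∀ {Γ} → Formula Γ → Formula Γ → Formula Γ
  A ⇔ᶠ B = (A ⇛ B) ∧ᶠ (B ⇛ A)

  Ren : Ctx → Ctx → Set
  Ren Γ Δ = ∀ {s} → Var Γ s → Var Δ s

  liftR : ∀ {Γ Δ s} → Ren Γ Δ → Ren (s ∷ Γ) (s ∷ Δ)
  liftR r vz     = vz
  liftR r (vs x) = vs (r x)

  renT  : ∀ {Γ Δ s}  → Ren Γ Δ → Term Γ s → Term Δ s
  renTs : ∀ {Γ Δ ss} → Ren Γ Δ → Terms Γ ss → Terms Δ ss
  renT r (var x)    = var (r x)
  renT r (app f ts) = app f (renTs r ts)
  renTs r []       = []
  renTs r (t ∷ ts) = renT r t ∷ renTs r ts

  renF : ∀ {Γ Δ} → Ren Γ Δ → Formula Γ → Formula Δ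
  renF r (atom p ts) = atom p (renTs r ts)
  renF r Top         = Top
  renF r Bot         = Bot
  renF r (A ⇛ B)     = renF r A ⇛ renF r B
  renF r (A ∧ᶠ B)    = renF r A ∧ᶠ renF r B
  renF r (A ∨ᶠ B)    = renF r A ∨ᶠ renF r B
  renF r (∀ᶠ s A)    = ∀ᶠ s (renF (liftR r) A)
  renF r (∃ᶠ s A)    = ∃ᶠ s (renF (liftR r) A)

  wkT : ∀ {Γ s s'} → Term Γ s → Term (s' ∷ Γ) s
  wkT = renT vs

  wkF : ∀ {Γ s'} → Formula Γ → Formula (s' ∷ Γ)
  wkF = renF vs

  closedT : ∀ {Γ s} → Term [] s → Term Γ s
  closedT = renT (λ ())

  closedF : ∀ {Γ} → Formula [] → Formula Γ
  closedF = renF (λ ())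

  Sub : Ctx → Ctx → Set
  Sub Γ Δ = ∀ {s} → Var Γ s → Term Δ s

  liftS : ∀ {Γ Δ s} → Sub Γ Δ → Sub (s ∷ Γ) (s ∷ Δ)
  liftS σ vz     = var vz
  liftS σ (vs x) = wkT (σ x)

  subT  : ∀ {Γ Δ s}  → Sub Γ Δ → Term Γ s → Term Δ s
  subTs : ∀ {Γ Δ ss} → Sub Γ Δ → Terms Γ ss → Terms Δ ss
  subT σ (var x)    = σ x
  subT σ (app f ts) = app f (subTs σ ts)
  subTs σ []       = []
  subTs σ (t ∷ ts) = subT σ t ∷ subTs σ ts

  subF : ∀ {Γ Δ} → Sub Γ Δ → Formula Γ → Formula Δ
  subF σ (atom p ts) = atom p (subTs σ ts)
  subF σ Top         = Top
  subF σ Bot         = Bot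
  subF σ (A ⇛ B)     = subF σ A ⇛ subF σ B
  subF σ (A ∧ᶠ B)    = subF σ A ∧ᶠ subF σ B
  subF σ (A ∨ᶠ B)    = subF σ A ∨ᶠ subF σ B
  subF σ (∀ᶠ s A)    = ∀ᶠ s (subF (liftS σ) A)
  subF σ (∃ᶠ s A)    = ∃ᶠ s (subF (liftS σ) A)

  sub0 : ∀ {Γ s} → Term Γ s → Sub (s ∷ Γ) Γ
  sub0 t vz     = t
  sub0 t (vs x) = var x

  _[_]ᶠ : ∀ {Γ s} → Formula (s ∷ Γ) → Term Γ s → Formula Γ
  A [ t ]ᶠ = subF (sub0 t) A

  -- simultaneous instantiation of all variables of a "macro"
  -- (a term/formula over context Δ); the head of Δ is the first argument
  toSub : ∀ {Γ Δ} → Terms Γ Δ → Sub Δ Γ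
  toSub (t ∷ ts) vz     = t
  toSub (t ∷ ts) (vs x) = toSub ts x

  instT : ∀ {Γ Δ s} → Term Δ s → Terms Γ Δ → Term Γ s
  instT t ts = subT (toSub ts) t

  instF : ∀ {Γ Δ} → Formula Δ → Terms Γ Δ → Formula Γ
  instF A ts = subF (toSub ts) A

  inst1 : ∀ {Γ Γ' s} → Formula (s ∷ Γ) → Ren Γ Γ' → Term Γ' s → Formula Γ'
  inst1 A r t = subF σ A
    where
      σ : Sub _ _
      σ vz     = t
      σ (vs x) = var (r x)

  conj : ∀ {Γ} → List (Formula Γ) → Formula Γ
  conj []           = Top
  conj (A ∷ [])     = A
  conj (A ∷ B ∷ As) = A ∧ᶠ conj (B ∷ As)

  closeAll : (Γ : Ctx) → Formula Γ → Formula []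
  closeAll []      A = A
  closeAll (s ∷ Γ) A = closeAll Γ (∀ᶠ s A)

record Theory : Set₁ where
  field
    sig     : Signature
    axiom   : Syntax.Formula sig [] → Set
    _≡ᵀ_    : ∀ {Γ} → Syntax.Formula sig Γ → Syntax.Formula sig Γ → Set

module _ (𝒯 : Theory) where
  open Theory 𝒯
  open Signature sig
  open Syntax sig

  -- Natural deduction; "every rule applied modulo ≡" is rendered by the
  -- conversion rule `conv` (equivalent for a congruence ≡).
  data Der : (Γ : Ctx) → List (Formula Γ) → Formula Γ → Set where
    hyp  : ∀ {Γ H A} → A ∈ H → Der Γ H A
    ax   : ∀ {Γ H A} → axiom A → Der Γ H (closedF A)
    conv : ∀ {Γ H A B} → Der Γ H A → A ≡ᵀ B → Der Γ H B
    ⇛I   : ∀ {Γ H A B} → Der Γ (A ∷ H) B → Der Γ H (A ⇛ B)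
    ⇛E   : ∀ {Γ H A B} → Der Γ H (A ⇛ B) → Der Γ H A → Der Γ H B
    ∧I   : ∀ {Γ H A B} → Der Γ H A → Der Γ H B → Der Γ H (A ∧ᶠ B)
    ∧E₁  : ∀ {Γ H A B} → Der Γ H (A ∧ᶠ B) → Der Γ H A
    ∧E₂  : ∀ {Γ H A B} → Der Γ H (A ∧ᶠ B) → Der Γ H B
    ∨I₁  : ∀ {Γ H A B} → Der Γ H A → Der Γ H (A ∨ᶠ B)
    ∨I₂  : ∀ {Γ H A B} → Der Γ H B → Der Γ H (A ∨ᶠ B)
    ∨E   : ∀ {Γ H A B C} → Der Γ H (A ∨ᶠ B) → Der Γ (A ∷ H) C → Der Γ (B ∷ H) C
         → Der Γ H C
    ⊤I   : ∀ {Γ H} → Der Γ H Top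
    ⊥E   : ∀ {Γ H A} → Der Γ H Bot → Der Γ H A
    ∀I   : ∀ {Γ H s A} → Der (s ∷ Γ) (map wkF H) A → Der Γ H (∀ᶠ s A)
    ∀E   : ∀ {Γ H s A} → Der Γ H (∀ᶠ s A) → (t : Term Γ s) → Der Γ H (A [ t ]ᶠ)
    ∃I   : ∀ {Γ H s A} → (t : Term Γ s) → Der Γ H (A [ t ]ᶠ) → Der Γ H (∃ᶠ s A)
    ∃E   : ∀ {Γ H s A C} → Der Γ H (∃ᶠ s A) → Der (s ∷ Γ) (A ∷ map wkF H) (wkF C)
         → Der Γ H C

  Provable : Formula [] → Set
  Provable A = Der [] [] A

record TheoryT : Set₁ where
  field
    sig   : Signature
    _≡ᵀ_  : ∀ {Γ} → Syntax.Formula sig Γ → Syntax.Formula sig Γ → Set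

-- The part of the interpretation ⌜·⌝ of 𝒮 in 𝒰 used by the realizability
-- translation: the target sort ⌜𝓛⌝ and the translations of the relevant
-- 𝒮-formulas / 𝒮-function symbols, as formula / term macros of 𝒰
-- (the head of the macro context is the first argument).

module _ (𝒰 : Theory) where
  open Theory 𝒰
  open Signature sig
  open Syntax sig

  record SCoding (TSort : Set) : Set where
    field
      L        : Sort
      SN       : Formula (L ∷ [])
      Proof    : Formula (L ∷ [])
      ProofVar : Formula (L ∷ [])
      Elim     : Formula (L ∷ [])
      Red      : Formula (L ∷ L ∷ [])
      Red*     : Formula (L ∷ L ∷ [])
      TermP    : Formula (L ∷ L ∷ [])
      sortCode : TSort → Term [] L
      Axiom    : Term (L ∷ []) L
      ImpI     : Term (L ∷ L ∷ []) L
      AndI     : Term (L ∷ L ∷ []) L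
      OrI₁     : Term (L ∷ []) L
      OrI₂     : Term (L ∷ []) L
      ForallI  : Term (L ∷ L ∷ []) L
      ExistsI  : Term (L ∷ L ∷ []) L
      TSubst   : Term (L ∷ L ∷ L ∷ []) L
      PSubst   : Term (L ∷ L ∷ L ∷ []) L

module Realizability (𝒯 : TheoryT) (𝒰 : Theory) where
  module T = Syntax (TheoryT.sig 𝒯)
  module U = Syntax (Theory.sig 𝒰)
  open Signature (TheoryT.sig 𝒯)
    using () renaming (Sort to TSort; funArgs to tArgs; funRes to tRes;
                       Fun to TFun; Pred to TPred; predArgs to tpArgs)
  open Signature (Theory.sig 𝒰) using () renaming (Sort to USort)
  open TheoryT 𝒯 using (_≡ᵀ_)

  record Translation (C : SCoding 𝒰 TSort) : Set where
    open SCoding C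
    field
      sort* : TSort → USort
      pred* : (s : TSort) → U.Formula (sort* s ∷ [])
      fun*  : (f : TFun) → U.Term (map sort* (tArgs f)) (sort* (tRes f))
      real* : (p : TPred) → U.Formula (L ∷ map sort* (tpArgs p))

  module Trans {C : SCoding 𝒰 TSort} (R : Translation C) where
    open SCoding C
    open Translation R
    open U

    SN[_] : ∀ {Γ} → Term Γ L → Formula Γ
    SN[ π ] = instF SN (π ∷ [])

    Red*[_,_] : ∀ {Γ} → Term Γ L → Term Γ L → Formula Γ
    Red*[ π , π' ] = instF Red* (π ∷ π' ∷ [])

    Env : T.Ctx → Ctx → Set
    Env Δ Γ = ∀ {s} → T.Var Δ s → Term Γ (sort* s)

    wkE : ∀ {Δ Γ s'} → Env Δ Γ → Env Δ (s' ∷ Γ)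
    wkE ρ x = wkT (ρ x)

    extE : ∀ {Δ Γ s} → Env Δ Γ → Term Γ (sort* s) → Env (s ∷ Δ) Γ
    extE ρ t T.vz     = t
    extE ρ t (T.vs x) = ρ x

    trT  : ∀ {Δ Γ s}  → Env Δ Γ → T.Term Δ s → Term Γ (sort* s)
    trTs : ∀ {Δ Γ ss} → Env Δ Γ → T.Terms Δ ss → Terms Γ (map sort* ss)
    trT ρ (T.var x)    = ρ x
    trT ρ (T.app f ts) = instT (fun* f) (trTs ρ ts)
    trTs ρ T.[]       = []
    trTs ρ (t T.∷ ts) = trT ρ t ∷ trTs ρ ts

    ⊩ : ∀ {Δ Γ} → T.Formula Δ → Env Δ Γ → Term Γ L → Formula Γ
    ⊩ (T.atom p ts) ρ π = instF (real* p) (π ∷ trTs ρ ts)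
    ⊩ T.Top         ρ π = SN[ π ]
    ⊩ T.Bot         ρ π = SN[ π ]
    ⊩ (A T.⇛ B)     ρ π =
      SN[ π ] ∧ᶠ
      ∀ᶠ L (∀ᶠ L                                  -- ∀α ∀π'   (π' = vz, α = vs vz)
        (Red*[ wkT (wkT π) , instT ImpI (var (vs vz) ∷ var vz ∷ []) ] ⇛
         ∀ᶠ L                                      -- ∀φ       (φ = vz)
           (⊩ A ρ₃ (var vz) ⇛
            ⊩ B ρ₃ (instT PSubst (var (vs vz) ∷ var (vs (vs vz)) ∷ var vz ∷ [])))))
      where ρ₃ = wkE (wkE (wkE ρ))
    ⊩ (A T.∧ᶠ B)    ρ π =
      SN[ π ] ∧ᶠ
      ∀ᶠ L (∀ᶠ L                                  -- ∀π₁ ∀π₂  (π₂ = vz, π₁ = vs vz)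
        (Red*[ wkT (wkT π) , instT AndI (var (vs vz) ∷ var vz ∷ []) ] ⇛
         (⊩ A (wkE (wkE ρ)) (var (vs vz)) ∧ᶠ ⊩ B (wkE (wkE ρ)) (var vz))))
    ⊩ (A T.∨ᶠ B)    ρ π =
      SN[ π ] ∧ᶠ
      (∀ᶠ L (Red*[ wkT π , instT OrI₁ (var vz ∷ []) ] ⇛ ⊩ A (wkE ρ) (var vz)) ∧ᶠ
       ∀ᶠ L (Red*[ wkT π , instT OrI₂ (var vz ∷ []) ] ⇛ ⊩ B (wkE ρ) (var vz)))
    ⊩ (T.∀ᶠ s A)    ρ π =
      SN[ π ] ∧ᶠ
      ∀ᶠ L (∀ᶠ L                                  -- ∀v ∀π'   (π' = vz, v = vs vz)
        (Red*[ wkT (wkT π) , instT ForallI (var (vs vz) ∷ var vz ∷ []) ] ⇛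
         ∀ᶠ (sort* s) (∀ᶠ L                        -- ∀x* ∀t   (t = vz, x* = vs vz)
           ((instF (pred* s) (var (vs vz) ∷ []) ∧ᶠ
             instF TermP (var vz ∷ closedT (sortCode s) ∷ [])) ⇛
            ⊩ A (extE (wkE (wkE (wkE (wkE ρ)))) (var (vs vz)))
                (instT TSubst (var (vs (vs vz)) ∷ var (vs (vs (vs vz))) ∷ var vz ∷ []))))))
    ⊩ (T.∃ᶠ s A)    ρ π =
      SN[ π ] ∧ᶠ
      ∀ᶠ L (∀ᶠ L                                  -- ∀π' ∀t   (t = vz, π' = vs vz)
        (Red*[ wkT (wkT π) , instT ExistsI (var vz ∷ var (vs vz) ∷ []) ] ⇛
         ∃ᶠ (sort* s)                              -- ∃x*      (x* = vz)
           (instF (pred* s) (var vz ∷ []) ∧ᶠ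
            ⊩ A (extE (wkE (wkE (wkE ρ))) (var vz)) (var (vs (vs vz))))))

    -- CR_π(A(π)), for A a formula with the extra (most recent) variable π
    CR : ∀ {Γ} → Formula (L ∷ Γ) → Formula Γ
    CR A =
      ∀ᶠ L (inst1 A (λ x → vs x) (var vz) ⇛
            (instF Proof (var vz ∷ []) ∧ᶠ SN[ var vz ])) ∧ᶠ
      (∀ᶠ L (instF ProofVar (var vz ∷ []) ⇛
             inst1 A (λ x → vs x) (instT Axiom (var vz ∷ []))) ∧ᶠ
      (∀ᶠ L (∀ᶠ L ((inst1 A (λ x → vs (vs x)) (var (vs vz)) ∧ᶠ
                    instF Red (var (vs vz) ∷ var vz ∷ [])) ⇛
                   inst1 A (λ x → vs (vs x)) (var vz))) ∧ᶠ
       ∀ᶠ L ((instF Elim (var vz ∷ []) ∧ᶠ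
              ∀ᶠ L (instF Red (var (vs vz) ∷ var vz ∷ []) ⇛
                    inst1 A (λ x → vs (vs x)) (var vz))) ⇛
             inst1 A (λ x → vs x) (var vz))))

    rels : (ss : List TSort) → List (Formula (map sort* ss))
    rels []       = []
    rels (s ∷ ss) = instF (pred* s) (var vz ∷ []) ∷ map wkF (rels ss)

    varE : ∀ {Δ s} → T.Var Δ s → Var (map sort* Δ) (sort* s)
    varE T.vz     = vz
    varE (T.vs x) = vs (varE x)

    ρ₀ : ∀ {Δ} → Env Δ (map sort* Δ)
    ρ₀ x = var (varE x)

    corollaryFormula : ∀ {Δ} → T.Formula Δ → Formula []
    corollaryFormula {Δ} A =
      closeAll (map sort* Δ)
        (∀ᶠ L (conj (map wkF (rels Δ) ++ (⊩ A (wkE ρ₀) (var vz) ∷ [])) ⇛ SN[ var vz ]))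

  record Interpretation (C : SCoding 𝒰 TSort) : Set₁ where
    field
      translation : Translation C
    open SCoding C
    open Translation translation
    open Trans translation
    open U
    field
      -- (1)
      inhabited : (s : TSort) → Provable 𝒰 (∃ᶠ (sort* s) (pred* s))
      -- (2)
      funClosed : (f : TFun) →
        Provable 𝒰 (closeAll (map sort* (tArgs f))
          (conj (rels (tArgs f)) ⇛ instF (pred* (tRes f)) (fun* f ∷ [])))
      -- (3)
      predCR : (p : TPred) →
        Provable 𝒰 (closeAll (map sort* (tpArgs p))
          (conj (rels (tpArgs p)) ⇛ CR (real* p)))
      -- (4)
      congruence : ∀ {Δ} (A A' : T.Formula Δ) → A ≡ᵀ A' →
        Provable 𝒰 (closeAll (map sort* Δ)
          (conj (rels Δ) ⇛ ∀ᶠ L (⊩ A (wkE ρ₀) (var vz) ⇔ᶠ ⊩ A' (wkE ρ₀) (var vz))))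

module Submission where

open import Data.List using (List; []; _∷_; map; _++_)
open import Data.List.Membership.Propositional using (_∈_)
open import Data.List.Membership.Propositional.Properties using (∈-map⁺; ∈-++⁺ˡ; ∈-++⁺ʳ)
open import Data.List.Relation.Unary.Any using (here; there)
open import Data.List.Relation.Unary.All as All using (All; []; _∷_)
open import Data.List.Relation.Unary.All.Properties using (++⁺; map⁺)
open import Data.Product using (_×_; _,_)
open import Data.Unit using (⊤; tt)
open import Relation.Binary.PropositionalEquality
open import Defs

-- Every clause of the realizability translation except the atomic one starts
-- with the conjunct ⌜SN⌝(π), so for a compound formula the claim is a
-- conjunction elimination. For an atom p(t⃗), the hypotheses s*(x*) propagate
-- to the translated terms t⃗* by closure of the sort predicates under the
-- function symbols (condition 2); condition 3 then applies to π ⊩ p(t⃗*), and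
-- the first clause of CR gives ⌜SN⌝(π). The closed theorems provided by
-- conditions 2 and 3 are used as hypotheses and discharged at the end.

module SubstitutionLemmas (Σ : Signature) where
  open Syntax Σ

  _≗ˢ_ : ∀ {Γ Δ} → Sub Γ Δ → Sub Γ Δ → Set
  σ ≗ˢ τ = ∀ {s} (x : Var _ s) → σ x ≡ τ x

  ∅ˢ : ∀ {Γ} → Sub [] Γ
  ∅ˢ ()

  subT-cong  : ∀ {Γ Δ s} {σ τ : Sub Γ Δ} → σ ≗ˢ τ → (t : Term Γ s) → subT σ t ≡ subT τ t
  subTs-cong : ∀ {Γ Δ ss} {σ τ : Sub Γ Δ} → σ ≗ˢ τ → (ts : Terms Γ ss) → subTs σ ts ≡ subTs τ ts
  subT-cong eq (var x)    = eq x
  subT-cong eq (app f ts) = cong (app f) (subTs-cong eq ts)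
  subTs-cong eq []       = refl
  subTs-cong eq (t ∷ ts) = cong₂ _∷_ (subT-cong eq t) (subTs-cong eq ts)

  subT-subT  : ∀ {Γ Δ Θ s} (τ : Sub Δ Θ) (σ : Sub Γ Δ) (t : Term Γ s) →
               subT τ (subT σ t) ≡ subT (λ x → subT τ (σ x)) t
  subTs-subTs : ∀ {Γ Δ Θ ss} (τ : Sub Δ Θ) (σ : Sub Γ Δ) (ts : Terms Γ ss) →
                subTs τ (subTs σ ts) ≡ subTs (λ x → subT τ (σ x)) ts
  subT-subT τ σ (var x)    = refl
  subT-subT τ σ (app f ts) = cong (app f) (subTs-subTs τ σ ts)
  subTs-subTs τ σ []       = refl
  subTs-subTs τ σ (t ∷ ts) = cong₂ _∷_ (subT-subT τ σ t) (subTs-subTs τ σ ts)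

  subT-id  : ∀ {Γ s} (t : Term Γ s) → subT var t ≡ t
  subTs-id : ∀ {Γ ss} (ts : Terms Γ ss) → subTs var ts ≡ ts
  subT-id (var x)    = refl
  subT-id (app f ts) = cong (app f) (subTs-id ts)
  subTs-id []       = refl
  subTs-id (t ∷ ts) = cong₂ _∷_ (subT-id t) (subTs-id ts)

  renT≡subT  : ∀ {Γ Δ s} (r : Ren Γ Δ) (t : Term Γ s) → renT r t ≡ subT (λ x → var (r x)) t
  renTs≡subTs : ∀ {Γ Δ ss} (r : Ren Γ Δ) (ts : Terms Γ ss) → renTs r ts ≡ subTs (λ x → var (r x)) ts
  renT≡subT r (var x)    = refl
  renT≡subT r (app f ts) = cong (app f) (renTs≡subTs r ts)
  renTs≡subTs r []       = refl
  renTs≡subTs r (t ∷ ts) = cong₂ _∷_ (renT≡subT r t) (renTs≡subTs r ts)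

  subT-wkT : ∀ {Γ Δ s s'} (σ : Sub (s' ∷ Γ) Δ) (t : Term Γ s) → subT σ (wkT t) ≡ subT (λ x → σ (vs x)) t
  subT-wkT σ t = trans (cong (subT σ) (renT≡subT vs t)) (subT-subT σ _ t)

  sub0-wkT : ∀ {Γ s s'} (u : Term Γ s') (t : Term Γ s) → subT (sub0 u) (wkT t) ≡ t
  sub0-wkT u t = trans (subT-wkT (sub0 u) t) (subT-id t)

  liftS-cong : ∀ {Γ Δ s} {σ τ : Sub Γ Δ} → σ ≗ˢ τ → liftS {s = s} σ ≗ˢ liftS τ
  liftS-cong eq vz     = refl
  liftS-cong eq (vs x) = cong wkT (eq x)

  liftS-liftS : ∀ {Γ Δ Θ s} (τ : Sub Δ Θ) (σ : Sub Γ Δ) →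
                (λ x → subT (liftS τ) (liftS {s = s} σ x)) ≗ˢ liftS (λ x → subT τ (σ x))
  liftS-liftS τ σ vz     = refl
  liftS-liftS τ σ (vs x) = begin
    subT (liftS τ) (wkT (σ x))                   ≡⟨ subT-wkT (liftS τ) (σ x) ⟩
    subT (λ y → wkT (τ y)) (σ x)                 ≡⟨ subT-cong (λ y → renT≡subT vs (τ y)) (σ x) ⟩
    subT (λ y → subT (λ z → var (vs z)) (τ y)) (σ x) ≡˘⟨ subT-subT _ τ (σ x) ⟩
    subT (λ z → var (vs z)) (subT τ (σ x))       ≡˘⟨ renT≡subT vs (subT τ (σ x)) ⟩
    wkT (subT τ (σ x))                           ∎
    where open ≡-Reasoning

  subF-cong : ∀ {Γ Δ} {σ τ : Sub Γ Δ} → σ ≗ˢ τ → (A : Formula Γ) → subF σ A ≡ subF τ A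
  subF-cong eq (atom p ts) = cong (atom p) (subTs-cong eq ts)
  subF-cong eq Top         = refl
  subF-cong eq Bot         = refl
  subF-cong eq (A ⇛ B)     = cong₂ _⇛_ (subF-cong eq A) (subF-cong eq B)
  subF-cong eq (A ∧ᶠ B)    = cong₂ _∧ᶠ_ (subF-cong eq A) (subF-cong eq B)
  subF-cong eq (A ∨ᶠ B)    = cong₂ _∨ᶠ_ (subF-cong eq A) (subF-cong eq B)
  subF-cong eq (∀ᶠ s A)    = cong (∀ᶠ s) (subF-cong (liftS-cong eq) A)
  subF-cong eq (∃ᶠ s A)    = cong (∃ᶠ s) (subF-cong (liftS-cong eq) A)

  subF-subF : ∀ {Γ Δ Θ} (τ : Sub Δ Θ) (σ : Sub Γ Δ) (A : Formula Γ) →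
              subF τ (subF σ A) ≡ subF (λ x → subT τ (σ x)) A
  subF-subF τ σ (atom p ts) = cong (atom p) (subTs-subTs τ σ ts)
  subF-subF τ σ Top         = refl
  subF-subF τ σ Bot         = refl
  subF-subF τ σ (A ⇛ B)     = cong₂ _⇛_ (subF-subF τ σ A) (subF-subF τ σ B)
  subF-subF τ σ (A ∧ᶠ B)    = cong₂ _∧ᶠ_ (subF-subF τ σ A) (subF-subF τ σ B)
  subF-subF τ σ (A ∨ᶠ B)    = cong₂ _∨ᶠ_ (subF-subF τ σ A) (subF-subF τ σ B)
  subF-subF τ σ (∀ᶠ s A)    =
    cong (∀ᶠ s) (trans (subF-subF (liftS τ) (liftS σ) A) (subF-cong (liftS-liftS τ σ) A))
  subF-subF τ σ (∃ᶠ s A)    =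
    cong (∃ᶠ s) (trans (subF-subF (liftS τ) (liftS σ) A) (subF-cong (liftS-liftS τ σ) A))

  liftS-var : ∀ {Γ s} → liftS {s = s} (var {Γ}) ≗ˢ var
  liftS-var vz     = refl
  liftS-var (vs x) = refl

  subF-id : ∀ {Γ} (A : Formula Γ) → subF var A ≡ A
  subF-id (atom p ts) = cong (atom p) (subTs-id ts)
  subF-id Top         = refl
  subF-id Bot         = refl
  subF-id (A ⇛ B)     = cong₂ _⇛_ (subF-id A) (subF-id B)
  subF-id (A ∧ᶠ B)    = cong₂ _∧ᶠ_ (subF-id A) (subF-id B)
  subF-id (A ∨ᶠ B)    = cong₂ _∨ᶠ_ (subF-id A) (subF-id B)
  subF-id (∀ᶠ s A)    = cong (∀ᶠ s) (trans (subF-cong liftS-var A) (subF-id A))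
  subF-id (∃ᶠ s A)    = cong (∃ᶠ s) (trans (subF-cong liftS-var A) (subF-id A))

  liftS-ren : ∀ {Γ Δ s} (r : Ren Γ Δ) → liftS {s = s} (λ x → var (r x)) ≗ˢ (λ x → var (liftR r x))
  liftS-ren r vz     = refl
  liftS-ren r (vs x) = refl

  renF≡subF : ∀ {Γ Δ} (r : Ren Γ Δ) (A : Formula Γ) → renF r A ≡ subF (λ x → var (r x)) A
  renF≡subF r (atom p ts) = cong (atom p) (renTs≡subTs r ts)
  renF≡subF r Top         = refl
  renF≡subF r Bot         = refl
  renF≡subF r (A ⇛ B)     = cong₂ _⇛_ (renF≡subF r A) (renF≡subF r B)
  renF≡subF r (A ∧ᶠ B)    = cong₂ _∧ᶠ_ (renF≡subF r A) (renF≡subF r B)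
  renF≡subF r (A ∨ᶠ B)    = cong₂ _∨ᶠ_ (renF≡subF r A) (renF≡subF r B)
  renF≡subF r (∀ᶠ s A)    =
    cong (∀ᶠ s) (trans (renF≡subF (liftR r) A) (sym (subF-cong (liftS-ren r) A)))
  renF≡subF r (∃ᶠ s A)    =
    cong (∃ᶠ s) (trans (renF≡subF (liftR r) A) (sym (subF-cong (liftS-ren r) A)))

  subF-wkF : ∀ {Γ Δ s'} (σ : Sub (s' ∷ Γ) Δ) (A : Formula Γ) → subF σ (wkF A) ≡ subF (λ x → σ (vs x)) A
  subF-wkF σ A = trans (cong (subF σ) (renF≡subF vs A)) (subF-subF σ _ A)

  wkF≡subF-wkT : ∀ {Γ Δ s'} (σ : Sub Γ Δ) (A : Formula Γ) →
                 wkF {s' = s'} (subF σ A) ≡ subF (λ x → wkT (σ x)) A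
  wkF≡subF-wkT σ A = trans (renF≡subF vs (subF σ A))
    (trans (subF-subF _ σ A) (subF-cong (λ x → sym (renT≡subT vs (σ x))) A))

  toSub-subTs : ∀ {Γ Δ Θ} (σ : Sub Δ Θ) (us : Terms Δ Γ) → (λ x → subT σ (toSub us x)) ≗ˢ toSub (subTs σ us)
  toSub-subTs σ (u ∷ us) vz     = refl
  toSub-subTs σ (u ∷ us) (vs x) = toSub-subTs σ us x

  subF-instF : ∀ {Γ Δ Θ} (σ : Sub Δ Θ) (A : Formula Γ) (us : Terms Δ Γ) →
               subF σ (instF A us) ≡ instF A (subTs σ us)
  subF-instF σ A us = trans (subF-subF σ (toSub us) A) (subF-cong (toSub-subTs σ us) A)

  wkF-instF : ∀ {Γ Δ s'} (A : Formula Γ) (us : Terms Δ Γ) → wkF {s' = s'} (instF A us) ≡ instF A (renTs vs us)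
  wkF-instF A us = trans (renF≡subF vs (instF A us))
    (trans (subF-instF _ A us) (cong (instF A) (sym (renTs≡subTs vs us))))

  subF-sub0-liftS : ∀ {Γ Δ s} (A : Formula (s ∷ Δ)) (us : Terms Γ Δ) (u : Term Γ s) →
                    subF (sub0 u) (subF (liftS (toSub us)) A) ≡ instF A (u ∷ us)
  subF-sub0-liftS A us u = trans (subF-subF (sub0 u) (liftS (toSub us)) A) (subF-cong pointwise A)
    where
      pointwise : (λ x → subT (sub0 u) (liftS (toSub us) x)) ≗ˢ toSub (u ∷ us)
      pointwise vz     = refl
      pointwise (vs x) = sub0-wkT u (toSub us x)

  inst1-vz : ∀ {Γ s} (A : Formula (s ∷ Γ)) → inst1 A (λ x → vs x) (var vz) ≡ A
  inst1-vz A = trans (subF-cong (λ { vz → refl ; (vs x) → refl }) A) (subF-id A)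

module DerivationLemmas (𝒰 : Theory) where
  open Syntax (Theory.sig 𝒰)
  open SubstitutionLemmas (Theory.sig 𝒰)

  cast : ∀ {Γ H A B} → A ≡ B → Der 𝒰 Γ H A → Der 𝒰 Γ H B
  cast {Γ} {H} = subst (Der 𝒰 Γ H)

  weakenAll : (Γ : Ctx) → List (Formula []) → List (Formula Γ)
  weakenAll []      Ax = Ax
  weakenAll (s ∷ Γ) Ax = map wkF (weakenAll Γ Ax)

  weakenAll-∈ : ∀ {Ax X} (Γ : Ctx) → X ∈ Ax → subF ∅ˢ X ∈ weakenAll Γ Ax
  weakenAll-∈ {Ax} {X} [] m =
    subst (_∈ Ax) (sym (trans (subF-cong (λ ()) X) (subF-id X))) m
  weakenAll-∈ {Ax} {X} (s ∷ Γ) m =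
    subst (_∈ map wkF (weakenAll Γ Ax)) (trans (wkF≡subF-wkT ∅ˢ X) (subF-cong (λ ()) X))
      (∈-map⁺ wkF (weakenAll-∈ Γ m))

  Available : ∀ {Γ} → List (Formula Γ) → List (Formula []) → Set
  Available {Γ} H Ax = ∀ {X} → X ∈ Ax → Der 𝒰 Γ H (subF ∅ˢ X)

  closeAll-I : ∀ Ax (Γ : Ctx) (B : Formula Γ) → Der 𝒰 Γ (weakenAll Γ Ax) B → Der 𝒰 [] Ax (closeAll Γ B)
  closeAll-I Ax []      B d = d
  closeAll-I Ax (s ∷ Γ) B d = closeAll-I Ax Γ (∀ᶠ s B) (∀I d)

  closeAll-E : ∀ {Γ H} (Δ : Ctx) (B : Formula Δ) →
               Der 𝒰 Γ H (subF ∅ˢ (closeAll Δ B)) → (ts : Terms Γ Δ) → Der 𝒰 Γ H (instF B ts)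
  closeAll-E []      B d []       = cast (subF-cong (λ ()) B) d
  closeAll-E (s ∷ Δ) B d (t ∷ ts) =
    cast (subF-sub0-liftS B ts t) (∀E (closeAll-E Δ (∀ᶠ s B) d ts) t)

  discharge : ∀ Ax {G} → All (Provable 𝒰) Ax → Der 𝒰 [] Ax G → Provable 𝒰 G
  discharge []       []       d = d
  discharge (X ∷ Ax) (p ∷ ps) d = ⇛E (discharge Ax ps (⇛I d)) p

  conj-E : ∀ {Γ H Y} (ys : List (Formula Γ)) → Der 𝒰 Γ H (conj ys) → Y ∈ ys → Der 𝒰 Γ H Y
  conj-E (y ∷ [])     d (here refl) = d
  conj-E (y ∷ z ∷ zs) d (here refl) = ∧E₁ d
  conj-E (y ∷ z ∷ zs) d (there m)   = conj-E (z ∷ zs) (∧E₂ d) m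

  conj-I : ∀ {Γ Δ H} (σ : Sub Δ Γ) (xs : List (Formula Δ)) →
           All (λ X → Der 𝒰 Γ H (subF σ X)) xs → Der 𝒰 Γ H (subF σ (conj xs))
  conj-I σ []           []       = ⊤I
  conj-I σ (x ∷ [])     (d ∷ []) = d
  conj-I σ (x ∷ y ∷ zs) (d ∷ ds) = ∧I d (conj-I σ (y ∷ zs) ds)

module RealizersAreSN (𝒯 : TheoryT) (𝒰 : Theory) (C : SCoding 𝒰 (Signature.Sort (TheoryT.sig 𝒯)))
    (R : Realizability.Interpretation 𝒯 𝒰 C) where
  open Realizability 𝒯 𝒰
  open Signature (TheoryT.sig 𝒯)
    using () renaming (Sort to TSort; funArgs to tArgs; funRes to tRes;
                       Fun to TFun; Pred to TPred; predArgs to tpArgs)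
  open Interpretation R
  open Translation translation
  open Trans translation
  open SCoding C
  open U
  open SubstitutionLemmas (Theory.sig 𝒰)
  open DerivationLemmas 𝒰

  D : (Γ : Ctx) → List (Formula Γ) → Formula Γ → Set
  D = Der 𝒰

  Relativized : ∀ {Γ} → List (Formula Γ) → (ss : List TSort) → Terms Γ (map sort* ss) → Set
  Relativized H []       []       = ⊤
  Relativized H (s ∷ ss) (t ∷ ts) = D _ H (instF (pred* s) (t ∷ [])) × Relativized H ss ts

  EnvRelativized : ∀ {Δ Γ} → List (Formula Γ) → Env Δ Γ → Set
  EnvRelativized {Δ} {Γ} H ρ = ∀ {s} (x : T.Var Δ s) → D Γ H (instF (pred* s) (ρ x ∷ []))

  rels-instF : ∀ {Γ H} (ss : List TSort) (ts : Terms Γ (map sort* ss)) → Relativized H ss ts →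
               All (λ X → D Γ H (instF X ts)) (rels ss)
  rels-instF []       []       _        = []
  rels-instF (s ∷ ss) (t ∷ ts) (d , ds) =
    cast (sym (subF-instF (toSub (t ∷ ts)) (pred* s) (var vz ∷ []))) d
    ∷ map⁺ (All.map (λ {X} → cast (sym (subF-wkF (toSub (t ∷ ts)) X))) (rels-instF ss ts ds))

  relativized-E : ∀ {Γ H} (ss : List TSort) (B : Formula (map sort* ss)) →
                  D Γ H (subF ∅ˢ (closeAll (map sort* ss) (conj (rels ss) ⇛ B))) →
                  (ts : Terms Γ (map sort* ss)) → Relativized H ss ts → D Γ H (instF B ts)
  relativized-E ss B d ts rs =
    ⇛E (closeAll-E _ _ d ts) (conj-I (toSub ts) (rels ss) (rels-instF ss ts rs))

  pred*-var-∈-rels : ∀ {Δ s} (x : T.Var Δ s) → instF (pred* s) (var (varE x) ∷ []) ∈ rels Δ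
  pred*-var-∈-rels T.vz     = here refl
  pred*-var-∈-rels (T.vs x) =
    there (subst (_∈ _) (wkF-instF (pred* _) (var (varE x) ∷ [])) (∈-map⁺ wkF (pred*-var-∈-rels x)))

  funClosed-axiom : TFun → Formula []
  funClosed-axiom f =
    closeAll (map sort* (tArgs f)) (conj (rels (tArgs f)) ⇛ instF (pred* (tRes f)) (fun* f ∷ []))

  predCR-axiom : TPred → Formula []
  predCR-axiom p = closeAll (map sort* (tpArgs p)) (conj (rels (tpArgs p)) ⇛ CR (real* p))

  funAxioms  : ∀ {Δ s} → T.Term Δ s → List (Formula [])
  funAxiomsᵗ : ∀ {Δ ss} → T.Terms Δ ss → List (Formula [])
  funAxioms (T.var x)    = []
  funAxioms (T.app f ts) = funClosed-axiom f ∷ funAxiomsᵗ ts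
  funAxiomsᵗ T.[]       = []
  funAxiomsᵗ (t T.∷ ts) = funAxioms t ++ funAxiomsᵗ ts

  funAxioms-provable  : ∀ {Δ s} (t : T.Term Δ s) → All (Provable 𝒰) (funAxioms t)
  funAxiomsᵗ-provable : ∀ {Δ ss} (ts : T.Terms Δ ss) → All (Provable 𝒰) (funAxiomsᵗ ts)
  funAxioms-provable (T.var x)    = []
  funAxioms-provable (T.app f ts) = funClosed f ∷ funAxiomsᵗ-provable ts
  funAxiomsᵗ-provable T.[]       = []
  funAxiomsᵗ-provable (t T.∷ ts) = ++⁺ (funAxioms-provable t) (funAxiomsᵗ-provable ts)

  trT-relativized  : ∀ {Δ Γ H s} (ρ : Env Δ Γ) → EnvRelativized H ρ →
                     (t : T.Term Δ s) → Available H (funAxioms t) →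
                     D Γ H (instF (pred* s) (trT ρ t ∷ []))
  trTs-relativized : ∀ {Δ Γ H ss} (ρ : Env Δ Γ) → EnvRelativized H ρ →
                     (ts : T.Terms Δ ss) → Available H (funAxiomsᵗ ts) →
                     Relativized H ss (trTs ρ ts)
  trT-relativized ρ ρ-rel (T.var x)    avail = ρ-rel x
  trT-relativized ρ ρ-rel (T.app f ts) avail =
    cast (subF-instF (toSub (trTs ρ ts)) (pred* (tRes f)) (fun* f ∷ []))
      (relativized-E (tArgs f) _ (avail (here refl)) (trTs ρ ts)
        (trTs-relativized ρ ρ-rel ts (λ m → avail (there m))))
  trTs-relativized ρ ρ-rel T.[]       avail = tt
  trTs-relativized ρ ρ-rel (t T.∷ ts) avail =
    trT-relativized ρ ρ-rel t (λ m → avail (∈-++⁺ˡ m)) ,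
    trTs-relativized ρ ρ-rel ts (λ m → avail (∈-++⁺ʳ (funAxioms t) m))

  CR⇒SN : ∀ {Γ Δ H} (A : Formula (L ∷ Δ)) (ts : Terms Γ Δ) (π : Term Γ L) →
          D Γ H (instF (CR A) ts) → D Γ H (instF A (π ∷ ts)) → D Γ H SN[ π ]
  CR⇒SN A ts π cr d = cast SN-eq (∧E₂ (⇛E (∀E (∧E₁ cr) π) (cast (sym A-eq) d)))
    where
      σ = liftS (toSub ts)
      A-eq : subF (sub0 π) (subF σ (inst1 A (λ x → vs x) (var vz))) ≡ instF A (π ∷ ts)
      A-eq = trans (cong (λ B → subF (sub0 π) (subF σ B)) (inst1-vz A)) (subF-sub0-liftS A ts π)
      SN-eq : subF (sub0 π) (subF σ SN[ var vz ]) ≡ SN[ π ]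
      SN-eq = trans (cong (subF (sub0 π)) (subF-instF σ SN (var vz ∷ [])))
                    (subF-instF (sub0 π) SN (var vz ∷ []))

  snAxioms : ∀ {Δ} → T.Formula Δ → List (Formula [])
  snAxioms (T.atom p ts) = predCR-axiom p ∷ funAxiomsᵗ ts
  snAxioms _             = []

  snAxioms-provable : ∀ {Δ} (A : T.Formula Δ) → All (Provable 𝒰) (snAxioms A)
  snAxioms-provable (T.atom p ts) = predCR p ∷ funAxiomsᵗ-provable ts
  snAxioms-provable T.Top         = []
  snAxioms-provable T.Bot         = []
  snAxioms-provable (A T.⇛ B)     = []
  snAxioms-provable (A T.∧ᶠ B)    = []
  snAxioms-provable (A T.∨ᶠ B)    = []
  snAxioms-provable (T.∀ᶠ s A)    = []
  snAxioms-provable (T.∃ᶠ s A)    = []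

  ⊩⇒SN : ∀ {Δ Γ H} (A : T.Formula Δ) (ρ : Env Δ Γ) (π : Term Γ L) →
         EnvRelativized H ρ → Available H (snAxioms A) → D Γ H (⊩ A ρ π) → D Γ H SN[ π ]
  ⊩⇒SN (T.atom p ts) ρ π ρ-rel avail d =
    CR⇒SN (real* p) (trTs ρ ts) π
      (relativized-E (tpArgs p) _ (avail (here refl)) (trTs ρ ts)
        (trTs-relativized ρ ρ-rel ts (λ m → avail (there m))))
      d
  ⊩⇒SN T.Top         ρ π ρ-rel avail d = d
  ⊩⇒SN T.Bot         ρ π ρ-rel avail d = d
  ⊩⇒SN (A T.⇛ B)     ρ π ρ-rel avail d = ∧E₁ d
  ⊩⇒SN (A T.∧ᶠ B)    ρ π ρ-rel avail d = ∧E₁ d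
  ⊩⇒SN (A T.∨ᶠ B)    ρ π ρ-rel avail d = ∧E₁ d
  ⊩⇒SN (T.∀ᶠ s A)    ρ π ρ-rel avail d = ∧E₁ d
  ⊩⇒SN (T.∃ᶠ s A)    ρ π ρ-rel avail d = ∧E₁ d

  hypotheses : ∀ {Δ} → T.Formula Δ → List (Formula (L ∷ map sort* Δ))
  hypotheses {Δ} A = map wkF (rels Δ) ++ (⊩ A (wkE ρ₀) (var vz) ∷ [])

  ⊩⇒SN-under-hypotheses : ∀ {Δ} (A : T.Formula Δ) →
    D (L ∷ map sort* Δ) (conj (hypotheses A) ∷ weakenAll (L ∷ map sort* Δ) (snAxioms A)) SN[ var vz ]
  ⊩⇒SN-under-hypotheses {Δ} A =
    ⊩⇒SN A (wkE ρ₀) (var vz) ρ₀-rel (λ m → hyp (there (weakenAll-∈ _ m)))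
      (conj-E (hypotheses A) (hyp (here refl)) (∈-++⁺ʳ (map wkF (rels Δ)) (here refl)))
    where
      ρ₀-rel : EnvRelativized _ (wkE ρ₀)
      ρ₀-rel {s} x =
        cast (wkF-instF (pred* s) (var (varE x) ∷ []))
          (conj-E (hypotheses A) (hyp (here refl)) (∈-++⁺ˡ (∈-map⁺ wkF (pred*-var-∈-rels x))))

corollary1 : (𝒯 : TheoryT) (𝒰 : Theory) (C : SCoding 𝒰 (Signature.Sort (TheoryT.sig 𝒯)))
    (R : Realizability.Interpretation 𝒯 𝒰 C) →
    ∀ {Δ} (A : Syntax.Formula (TheoryT.sig 𝒯) Δ) →
    Provable 𝒰 (Realizability.Trans.corollaryFormula 𝒯 𝒰
    (Realizability.Interpretation.translation R) A)
corollary1 𝒯 𝒰 C R {Δ} A =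
  discharge (snAxioms A) (snAxioms-provable A)
    (closeAll-I (snAxioms A) (map sort* Δ) _ (∀I (⇛I (⊩⇒SN-under-hypotheses A))))
  where
    open RealizersAreSN 𝒯 𝒰 C R
    open DerivationLemmas 𝒰
    open Realizability.Translation (Realizability.Interpretation.translation R)
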